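{- If $G$ is a connected graph, then $b(G) \le b_{\rm g}(G) \le \min\{\mathrm{CL}(G), 2b(G^2)-1\}$ and $b(G) \le b_{\rm g}'(G) \le \min\{\mathrm{CL}(G), 2b(G^2)\}$.
   Context: Burning process on a graph $G$: initially all vertices are unburned; in each round $t \ge 1$, every unburned vertex having a neighbor that was burned before round $t$ becomes burned and, simultaneously, one vertex that was unburned at the end of round $t-1$ is chosen (a source) and burned, if such a vertex exists; burned vertices stay burned; the process ends in the first round after which all vertices are burned. The burning number $b(G)$ is the minimum possible number of rounds of this process over all choices of sources, and the cooling number $\mathrm{CL}(G)$ is the maximum possible number of rounds. $G^2$ is the graph on $V(G)$ in which distinct vertices are adjacent iff their distance in $G$ is at most 2. The burning game on $G$ is played by Burner and Staller: each vertex is burned or unburned, and once burned stays burned. In round 1 the starting player burns one unburned vertex (selection phase only). Each round $t\ge 2$ consists of a spreading phase, in which every unburned vertex with a burned neighbor becomes burned, followed, if unburned vertices remain, by a selection phase in which the player whose turn it is burns one unburned vertex; players select alternately. The game ends in the first round in which all vertices are burned (possibly right after a spreading phase); its length is the number of that round. Burner minimizes the length, Staller maximizes it. $b_{\rm g}(G)$ is the optimal length when Burner selects first, and $b_{\rm g}'(G)$ when Staller selects first. -}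

module Defs where

open import Data.Nat using (ℕ; zero; suc; _⊔_; _⊓_)
open import Data.Bool using (Bool; true; false; _∧_; _∨_; not; if_then_else_)
open import Data.Fin using (Fin; _≟_)
open import Data.List using (List; []; _∷_; map; foldr; allFin)
open import Data.Bool.ListAction using (all; any)
open import Relation.Nullary.Decidable using (isYes)
open import Relation.Binary.PropositionalEquality using (_≡_)

Adj : ℕ → Set
Adj n = Fin n → Fin n → Bool

record SimpleGraph (n : ℕ) : Set where
  field
    adj    : Adj n
    sym    : ∀ u v → adj u v ≡ adj v u
    irrefl : ∀ v → adj v v ≡ false
open SimpleGraph public

data Walk {n : ℕ} (A : Adj n) : Fin n → Fin n → Set where
  here : ∀ {v} → Walk A v v
  step : ∀ {u w v} → A u w ≡ true → Walk A w v → Walk A u v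

Connected : ∀ {n} → SimpleGraph n → Set
Connected G = ∀ u v → Walk (adj G) u v

square : ∀ {n} → Adj n → Adj n
square {n} A u v =
  not (isYes (u ≟ v)) ∧ (A u v ∨ any (λ w → A u w ∧ A w v) (allFin n))

VSet : ℕ → Set
VSet n = Fin n → Bool

∅ : ∀ {n} → VSet n
∅ _ = false

full : ∀ {n} → VSet n → Bool
full {n} S = all S (allFin n)

add : ∀ {n} → VSet n → Fin n → VSet n
add S v w = S w ∨ isYes (w ≟ v)

spread : ∀ {n} → Adj n → VSet n → VSet n
spread {n} A S v = S v ∨ any (λ u → S u ∧ A u v) (allFin n)

unburned : ∀ {n} → VSet n → List (Fin n)
unburned {n} S = foldr (λ v vs → if S v then vs else v ∷ vs) [] (allFin n)

-- Minimum / maximum of a list (value on the empty list is irrelevant: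
-- it is only used on nonempty lists).
minOf : List ℕ → ℕ
minOf []       = 0
minOf (x ∷ xs) = foldr _⊓_ x xs

maxOf : List ℕ → ℕ
maxOf = foldr _⊔_ 0

-- Burning process.
-- process opt A k S = number of further rounds until everything is burned,
-- where S is the set burned at the end of the previous round, and the
-- sources are chosen optimally w.r.t. opt (min or max).  In each round the
-- source is any vertex unburned at the end of the previous round, and the new
-- burned set is (spread S) ∪ {source}.  k is fuel; since every round burns a
-- new vertex, fuel n (from the empty set) is never exhausted before the end.

process : ∀ {n} → (List ℕ → ℕ) → Adj n → ℕ → VSet n → ℕ
process opt A zero    S = 0
process opt A (suc k) S =
  if full S then 0
  else suc (opt (map (λ v → process opt A k (add (spread A S) v)) (unburned S)))

burningNumber : ∀ {n} → Adj n → ℕ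
burningNumber {n} A = process minOf A n ∅

coolingNumber : ∀ {n} → Adj n → ℕ
coolingNumber {n} A = process maxOf A n ∅

data Player : Set where
  Burner Staller : Player

other : Player → Player
other Burner  = Staller
other Staller = Burner

optimise : Player → List ℕ → ℕ
optimise Burner  = minOf
optimise Staller = maxOf

-- game A k p S = number of further rounds until the game ends (under optimal
-- play), where S is the burned set at the end of the current round and p is
-- the player who selects in the next round.  A round consists of spreading
-- (no effect in round 1, since S = ∅ then), and then, if unburned vertices
-- remain, a selection by p.  k is fuel (every round burns a new vertex, so
-- fuel n from ∅ suffices).

game : ∀ {n} → Adj n → ℕ → Player → VSet n → ℕ
game A zero    p S = 0
game A (suc k) p S =
  if full S then 0
  else (if full (spread A S) then 1
        else suc (optimise p
               (map (λ v → game A k (other p) (add (spread A S) v))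
                    (unburned (spread A S)))))

gameBurningNumber : ∀ {n} → Adj n → ℕ
gameBurningNumber {n} A = game A n Burner ∅

gameBurningNumber′ : ∀ {n} → Adj n → ℕ
gameBurningNumber′ {n} A = game A n Staller ∅

-- A play of the game is a run of the burning process in which the players choose the sources, so
-- its length lies between b(G) and CL(G).  For the other bound Burner imitates an optimal burning
-- sequence x₁, x₂, … of G²: in his i-th move he burns xᵢ, or any vertex if xᵢ is already burned.
-- One round of spreading in G² is covered by two rounds of spreading in G, and two game rounds
-- separate consecutive moves of Burner, so after his i-th move the burned set contains the one of
-- the G²-process after round i.  Hence the game lasts at most 2b(G²) rounds, one fewer if Burner
-- starts.
module Submission where

open import Defs
open import Data.Nat using (ℕ; _≤_; _⊓_; _*_; _∸_)
open import Data.Product using (_×_)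

open import Data.Nat using (zero; suc; _<_; z≤n; s≤s; s≤s⁻¹)
open import Data.Nat.Properties
  using (≤-refl; ≤-reflexive; ≤-trans; ≤-<-trans; <-≤-trans; <⇒≱; <⇒≤pred; m≤n⇒m≤1+n; m≤n*m; *-suc;
         pred[m∸n]≡m∸[1+n]; ⊓-sel; ⊓-glb; m≤n⇒m⊓o≤n; m≤n⇒o⊓m≤n; ⊔-lub; m≤n⇒m≤n⊔o; m≤n⇒m≤o⊔n)
open import Data.Bool using (Bool; true; false; T; _∧_; if_then_else_)
open import Data.Bool.ListAction using (any)
open import Data.Bool.Properties using (T-≡; T-∧; T-∨; ¬-not)
open import Data.Fin using (Fin)
open import Data.List using (List; []; _∷_; map; foldr; allFin; length)
open import Data.List.Properties using (foldr-preservesᵒ; foldr-preservesᵇ; length-tabulate)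
open import Data.List.Relation.Unary.Any using (Any; here; there; satisfied)
open import Data.List.Relation.Unary.Any.Properties using (any⁺; any⁻)
import Data.List.Relation.Unary.All as All
open import Data.List.Relation.Unary.All.Properties using (all⁺; all⁻; ¬All⇒Any¬)
open import Data.List.Membership.Propositional using (_∈_; lose)
open import Data.List.Membership.Propositional.Properties using (∈-allFin; ∈-map⁺; ∈-map⁻; foldr-selective)
open import Data.List.Relation.Binary.Subset.Propositional using (_⊆_)
open import Data.Product using (∃; _,_; proj₁; proj₂)
open import Data.Sum using (_⊎_; inj₁; inj₂; [_,_]; [_,_]′)
import Data.Sum as Sum
open import Data.Empty using (⊥-elim)
open import Function using (_∘_; id; Equivalence)
open import Relation.Nullary using (¬_; contradiction; yes; no)
open import Relation.Nullary.Decidable using (T?; toWitness; fromWitness)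
open import Relation.Binary.PropositionalEquality as ≡ using (_≡_; refl; cong; subst)

open Equivalence using (to; from)

private
  variable
    n : ℕ

minOf-≤ : ∀ {x xs} → x ∈ xs → minOf xs ≤ x
minOf-≤ {x} {y ∷ ys} x∈ =
  foldr-preservesᵒ (λ a b → [ m≤n⇒m⊓o≤n b , m≤n⇒o⊓m≤n a ]) y ys (case x∈)
  where
  case : x ∈ y ∷ ys → y ≤ x ⊎ Any (_≤ x) ys
  case (here refl) = inj₁ ≤-refl
  case (there x∈ys) = inj₂ (lose x∈ys ≤-refl)

minOf-∈ : ∀ {x xs} → x ∈ xs → minOf xs ∈ xs
minOf-∈ {xs = y ∷ ys} _ = [ here , there ]′ (foldr-selective {_•_ = _⊓_} ⊓-sel y ys)

≤-maxOf : ∀ {x xs} → x ∈ xs → x ≤ maxOf xs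
≤-maxOf {x} {xs} x∈ =
  foldr-preservesᵒ (λ a b → [ m≤n⇒m≤n⊔o b , m≤n⇒m≤o⊔n a ]) 0 xs (inj₂ (lose x∈ ≤-refl))

maxOf-≤ : ∀ {m} xs → (∀ {x} → x ∈ xs → x ≤ m) → maxOf xs ≤ m
maxOf-≤ xs bound = foldr-preservesᵇ ⊔-lub z≤n (All.tabulate bound)

maxOf-< : ∀ {m x} xs → x ∈ xs → (∀ {y} → y ∈ xs → y < m) → maxOf xs < m
maxOf-< xs x∈ bound = foldr-preservesᵇ ⊔-lub (≤-<-trans z≤n (bound x∈)) (All.tabulate bound)

minOf≤optimise : ∀ p {x xs} → x ∈ xs → minOf xs ≤ optimise p xs
minOf≤optimise Burner  _  = ≤-refl
minOf≤optimise Staller x∈ = ≤-trans (minOf-≤ x∈) (≤-maxOf x∈)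

optimise≤maxOf : ∀ p {x xs} → x ∈ xs → optimise p xs ≤ maxOf xs
optimise≤maxOf Burner  x∈ = ≤-trans (minOf-≤ x∈) (≤-maxOf x∈)
optimise≤maxOf Staller _  = ≤-refl

module _ {A : Set} {f g : A → ℕ} {xs ys : List A} (ys⊆xs : ys ⊆ xs) where

  minOf-map-mono : ∀ {y} → y ∈ ys → (∀ {z} → z ∈ ys → f z ≤ g z) →
                   minOf (map f xs) ≤ minOf (map g ys)
  minOf-map-mono y∈ f≤g with ∈-map⁻ g (minOf-∈ (∈-map⁺ g y∈))
  ... | z , z∈ , eq =
    ≤-trans (minOf-≤ (∈-map⁺ f (ys⊆xs z∈))) (≤-trans (f≤g z∈) (≤-reflexive (≡.sym eq)))

  maxOf-map-mono : (∀ {z} → z ∈ ys → g z ≤ f z) → maxOf (map g ys) ≤ maxOf (map f xs)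
  maxOf-map-mono g≤f = maxOf-≤ (map g ys) bound
    where
    bound : ∀ {x} → x ∈ map g ys → x ≤ maxOf (map f xs)
    bound x∈ with ∈-map⁻ g x∈
    ... | z , z∈ , refl = ≤-trans (g≤f z∈) (≤-maxOf (∈-map⁺ f (ys⊆xs z∈)))

_⊑_ : VSet n → VSet n → Set
S ⊑ S′ = ∀ {v} → T (S v) → T (S′ v)

full⇒∈ : ∀ {S : VSet n} → full S ≡ true → ∀ v → T (S v)
full⇒∈ {n} {S} e v = All.lookup (all⁺ S (allFin n) (from T-≡ e)) (∈-allFin v)

full-mono : ∀ {S S′ : VSet n} → S ⊑ S′ → full S ≡ true → full S′ ≡ true
full-mono {n} {S} {S′} S⊑S′ e =
  to T-≡ (all⁻ S′ {allFin n} (All.tabulate λ {v} _ → S⊑S′ (full⇒∈ {S = S} e v)))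

-- unburned S is unburnedIn S (allFin n); the generalisation allows induction on the list.
unburnedIn : VSet n → List (Fin n) → List (Fin n)
unburnedIn S = foldr (λ v vs → if S v then vs else v ∷ vs) []

∈-unburnedIn⁺ : ∀ {S : VSet n} {v xs} → v ∈ xs → ¬ T (S v) → v ∈ unburnedIn S xs
∈-unburnedIn⁺ {S = S} (here {x = y} refl) ¬Sy with S y
... | true  = contradiction _ ¬Sy
... | false = here refl
∈-unburnedIn⁺ {S = S} (there {x = y} v∈) ¬Sv with S y
... | true  = ∈-unburnedIn⁺ v∈ ¬Sv
... | false = there (∈-unburnedIn⁺ v∈ ¬Sv)

∈-unburnedIn⁻ : ∀ {S : VSet n} {v} xs → v ∈ unburnedIn S xs → ¬ T (S v)
∈-unburnedIn⁻ {S = S} (y ∷ ys) v∈ with S y in Sy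
∈-unburnedIn⁻ (y ∷ ys) v∈          | true  = ∈-unburnedIn⁻ ys v∈
∈-unburnedIn⁻ (y ∷ ys) (here refl) | false = subst T Sy
∈-unburnedIn⁻ (y ∷ ys) (there v∈)  | false = ∈-unburnedIn⁻ ys v∈

∈-unburned⁺ : ∀ {S : VSet n} {v} → ¬ T (S v) → v ∈ unburned S
∈-unburned⁺ {v = v} = ∈-unburnedIn⁺ (∈-allFin v)

∈-unburned⁻ : ∀ {S : VSet n} {v} → v ∈ unburned S → ¬ T (S v)
∈-unburned⁻ {n} = ∈-unburnedIn⁻ (allFin n)

unburned-anti : ∀ {S S′ : VSet n} → S ⊑ S′ → unburned S′ ⊆ unburned S
unburned-anti S⊑S′ v∈ = ∈-unburned⁺ (∈-unburned⁻ v∈ ∘ S⊑S′)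

¬full⇒∃unburned : ∀ (S : VSet n) → full S ≡ false → ∃ λ v → v ∈ unburned S
¬full⇒∃unburned {n} S e =
  let v , ¬Sv = satisfied (¬All⇒Any¬ (T? ∘ S) (allFin n) (subst T e ∘ all⁻ S)) in v , ∈-unburned⁺ ¬Sv

full-anti : ∀ {S S′ : VSet n} → S ⊑ S′ → full S′ ≡ false → full S ≡ false
full-anti {S = S} S⊑S′ e =
  ¬-not (λ fullS → contradiction (≡.trans (≡.sym (full-mono {S = S} S⊑S′ fullS)) e) λ ())

#unburned : VSet n → ℕ
#unburned S = length (unburned S)

unburnedIn-length-anti : ∀ {S S′ : VSet n} → S ⊑ S′ → ∀ xs →
                         length (unburnedIn S′ xs) ≤ length (unburnedIn S xs)
unburnedIn-length-anti S⊑S′ [] = z≤n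
unburnedIn-length-anti {S = S} {S′} S⊑S′ (y ∷ ys) with S y in Sy | S′ y in S′y
... | true  | true  = unburnedIn-length-anti S⊑S′ ys
... | true  | false = contradiction (S⊑S′ (from T-≡ Sy)) (subst T S′y)
... | false | true  = m≤n⇒m≤1+n (unburnedIn-length-anti S⊑S′ ys)
... | false | false = s≤s (unburnedIn-length-anti S⊑S′ ys)

unburnedIn-length-strict : ∀ {S S′ : VSet n} {x xs} → S ⊑ S′ → x ∈ xs → ¬ T (S x) → T (S′ x) →
                           length (unburnedIn S′ xs) < length (unburnedIn S xs)
unburnedIn-length-strict {S = S} {S′} S⊑S′ (here {x = y} {xs = ys} refl) ¬Sy S′y with S y | S′ y
... | true  | _     = contradiction _ ¬Sy
... | false | true  = s≤s (unburnedIn-length-anti S⊑S′ ys)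
unburnedIn-length-strict {S = S} {S′} S⊑S′ (there {x = y} x∈) ¬Sx S′x with S y in Sy | S′ y in S′y
... | true  | true  = unburnedIn-length-strict S⊑S′ x∈ ¬Sx S′x
... | true  | false = contradiction (S⊑S′ (from T-≡ Sy)) (subst T S′y)
... | false | true  = m≤n⇒m≤1+n (unburnedIn-length-strict S⊑S′ x∈ ¬Sx S′x)
... | false | false = s≤s (unburnedIn-length-strict S⊑S′ x∈ ¬Sx S′x)

#unburned-strict : ∀ {S S′ : VSet n} {x} → S ⊑ S′ → ¬ T (S x) → T (S′ x) →
                   #unburned S′ < #unburned S
#unburned-strict {x = x} S⊑S′ = unburnedIn-length-strict S⊑S′ (∈-allFin x)

unburnedIn-∅ : ∀ (xs : List (Fin n)) → unburnedIn ∅ xs ≡ xs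
unburnedIn-∅ []       = refl
unburnedIn-∅ (x ∷ xs) = cong (x ∷_) (unburnedIn-∅ xs)

#unburned-∅ : #unburned (∅ {n}) ≡ n
#unburned-∅ {n} = ≡.trans (cong length (unburnedIn-∅ (allFin n))) (length-tabulate _)

¬full⇒#unburned>0 : ∀ (S : VSet n) → full S ≡ false → 0 < #unburned S
¬full⇒#unburned>0 S e = nonempty (proj₂ (¬full⇒∃unburned S e))
  where
  nonempty : ∀ {A : Set} {x : A} {xs} → x ∈ xs → 0 < length xs
  nonempty (here _)  = s≤s z≤n
  nonempty (there _) = s≤s z≤n

add-incl : ∀ {S : VSet n} {v} → S ⊑ add S v
add-incl = from T-∨ ∘ inj₁

add-self : ∀ {S : VSet n} {v} → T (add S v v)
add-self {S = S} {v} = from (T-∨ {S v}) (inj₂ (fromWitness refl))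

add-elim : ∀ {S : VSet n} {v w} → T (add S v w) → T (S w) ⊎ w ≡ v
add-elim = Sum.map₂ toWitness ∘ to T-∨

add-covers : ∀ {W : VSet n} → full W ≡ false → ∀ x → ∃ λ v → v ∈ unburned W × T (add W v x)
add-covers {W = W} e x with T? (W x)
... | yes Wx = let v , v∈ = ¬full⇒∃unburned W e in v , v∈ , add-incl {S = W} Wx
... | no ¬Wx = x , ∈-unburned⁺ ¬Wx , add-self {S = W}

any-∧⁻ : ∀ {P Q : Fin n → Bool} → T (any (λ u → P u ∧ Q u) (allFin n)) → ∃ λ u → T (P u) × T (Q u)
any-∧⁻ {n} h = let u , p = satisfied (any⁻ _ (allFin n) h) in u , to T-∧ p

module _ (A : Adj n) where

  spread-incl : ∀ {S} → S ⊑ spread A S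
  spread-incl = from T-∨ ∘ inj₁

  spread-adj : ∀ {S u v} → T (S u) → T (A u v) → T (spread A S v)
  spread-adj {u = u} Su Auv = from T-∨ (inj₂ (any⁺ _ (lose (∈-allFin u) (from T-∧ (Su , Auv)))))

  spread-elim : ∀ {S v} → T (spread A S v) → T (S v) ⊎ ∃ λ u → T (S u) × T (A u v)
  spread-elim = Sum.map₂ any-∧⁻ ∘ to T-∨

  spread-mono : ∀ {S S′} → S ⊑ S′ → spread A S ⊑ spread A S′
  spread-mono S⊑S′ =
    [ spread-incl ∘ S⊑S′ , (λ (u , Su , Auv) → spread-adj (S⊑S′ Su) Auv) ]′ ∘ spread-elim

  spread-∅ : ∀ {v} → ¬ T (spread A ∅ v)
  spread-∅ {v} = [ (λ ()) , (λ { (_ , () , _) }) ]′ ∘ spread-elim {∅} {v}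

  square-adj : ∀ {u v} → T (square A u v) → T (A u v) ⊎ ∃ λ w → T (A u w) × T (A w v)
  square-adj = Sum.map₂ any-∧⁻ ∘ to T-∨ ∘ proj₂ ∘ to T-∧

#unburned-round : ∀ (A : Adj n) {S x} → x ∈ unburned S → #unburned (add (spread A S) x) < #unburned S
#unburned-round A {S} {x} x∈ =
  #unburned-strict {S = S} {x = x} (add-incl {S = spread A S} ∘ spread-incl A) (∈-unburned⁻ {S = S} x∈)
    (add-self {S = spread A S})

spread-square : ∀ (A : Adj n) {S} → spread (square A) S ⊑ spread A (spread A S)
spread-square A h with spread-elim (square A) h
... | inj₁ Sv = spread-incl A (spread-incl A Sv)
... | inj₂ (u , Su , A²uv) with square-adj A A²uv
...   | inj₁ Auv             = spread-incl A (spread-adj A Su Auv)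
...   | inj₂ (w , Auw , Awv) = spread-adj A (spread-adj A Su Auw) Awv

module _ (A : Adj n) where

  process-full : ∀ opt k {S} → full S ≡ true → process opt A k S ≡ 0
  process-full opt zero    _ = refl
  process-full opt (suc k) e rewrite e = refl

  process-unfold : ∀ opt k {S} → full S ≡ false →
    process opt A (suc k) S ≡ suc (opt (map (λ v → process opt A k (add (spread A S) v)) (unburned S)))
  process-unfold opt k e rewrite e = refl

  process-min≤game : ∀ k p S → process minOf A k S ≤ game A k p S
  process-min≤game zero    p S = z≤n
  process-min≤game (suc k) p S with full S in fullS
  ... | true  = z≤n
  ... | false with full (spread A S) in fullSpread
  ...   | true = s≤s (≤-trans (minOf-≤ (∈-map⁺ _ w∈)) (≤-reflexive (process-full minOf k burnedOut)))
    where
    w = proj₁ (¬full⇒∃unburned S fullS)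
    w∈ = proj₂ (¬full⇒∃unburned S fullS)
    burnedOut : full (add (spread A S) w) ≡ true
    burnedOut = full-mono {S = spread A S} (add-incl {S = spread A S}) fullSpread
  ...   | false = s≤s (≤-trans (minOf-map-mono {f = burning} {g = playing} (unburned-anti (spread-incl A {S}))
                                  v∈ (λ {v} _ → process-min≤game k (other p) (add (spread A S) v)))
                               (minOf≤optimise p (∈-map⁺ playing v∈)))
    where
    v∈ = proj₂ (¬full⇒∃unburned (spread A S) fullSpread)
    burning playing : Fin n → ℕ
    burning v = process minOf A k (add (spread A S) v)
    playing v = game A k (other p) (add (spread A S) v)

  game≤process-max : ∀ k p S → game A k p S ≤ process maxOf A k S
  game≤process-max zero    p S = z≤n
  game≤process-max (suc k) p S with full S
  ... | true  = z≤n
  ... | false with full (spread A S) in fullSpread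
  ...   | true  = s≤s z≤n
  ...   | false = s≤s (≤-trans (optimise≤maxOf p (∈-map⁺ playing v∈))
                               (maxOf-map-mono {f = burning} {g = playing} (unburned-anti (spread-incl A {S}))
                                  (λ {v} _ → game≤process-max k (other p) (add (spread A S) v))))
    where
    v∈ = proj₂ (¬full⇒∃unburned (spread A S) fullSpread)
    burning playing : Fin n → ℕ
    burning v = process maxOf A k (add (spread A S) v)
    playing v = game A k (other p) (add (spread A S) v)

  process-min-step : ∀ {k S} → #unburned S ≤ suc k → full S ≡ false →
    ∃ λ x → process minOf A (suc k) S ≡ suc (process minOf A k (add (spread A S) x))
          × #unburned (add (spread A S) x) ≤ k
  process-min-step {k} {S} fuel fullS =
    let w , w∈ = ¬full⇒∃unburned S fullS
        x , x∈ , minimal = ∈-map⁻ burning (minOf-∈ (∈-map⁺ burning w∈))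
    in x , ≡.trans (process-unfold minOf k fullS) (cong suc minimal) ,
       s≤s⁻¹ (≤-trans (#unburned-round A x∈) fuel)
    where
    burning : Fin n → ℕ
    burning v = process minOf A k (add (spread A S) v)

  process-min-pos : ∀ {k S} → #unburned S ≤ k → full S ≡ false → 0 < process minOf A k S
  process-min-pos {zero} {S} fuel fullS = contradiction fuel (<⇒≱ (¬full⇒#unburned>0 S fullS))
  process-min-pos {suc k} fuel fullS rewrite fullS = s≤s z≤n

<⇒≤∸1 : ∀ {m k} → m < k → m ≤ k ∸ 1
<⇒≤∸1 {m} {k} m<k = subst (m ≤_) (pred[m∸n]≡m∸[1+n] k 0) (<⇒≤pred m<k)

suc-<-double-suc : ∀ {m q} → m ≤ 2 * q → suc m < 2 * suc q
suc-<-double-suc {q = q} m≤2q = ≤-trans (s≤s (s≤s m≤2q)) (≤-reflexive (≡.sym (*-suc 2 q)))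

module _ (A : Adj n) where

  mutual
    game-Staller≤ : ∀ kg kp {S X} → #unburned S ≤ kp → S ⊑ X →
                    game A kg Staller X ≤ 2 * process minOf (square A) kp S
    game-Staller≤ zero     kp fuel S⊑X = z≤n
    game-Staller≤ (suc kg) kp {S} {X} fuel S⊑X with full X in fullX
    ... | true = z≤n
    ... | false with full (spread A X) in fullSpread
    ...   | true  = <-≤-trans (process-min-pos (square A) fuel (full-anti {S = S} S⊑X fullX)) (m≤n*m _ 2)
    ...   | false = maxOf-< _ (∈-map⁺ next v∈) bound
      where
      v∈ = proj₂ (¬full⇒∃unburned (spread A X) fullSpread)
      next : Fin n → ℕ
      next v = game A kg Burner (add (spread A X) v)
      bound : ∀ {y} → y ∈ map next (unburned (spread A X)) → y < 2 * process minOf (square A) kp S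
      bound y∈ with ∈-map⁻ next y∈
      ... | v , _ , refl = game-Burner< kg kp fuel (full-anti {S = S} S⊑X fullX)
            (spread-mono A (add-incl {S = spread A X}) ∘ spread-mono A (spread-mono A S⊑X) ∘ spread-square A)

    -- S is the burned set of the imitated process on G², and #unburned S ≤ kp ensures that its
    -- fuel kp does not run out.
    game-Burner< : ∀ kg kp {S U} → #unburned S ≤ kp → full S ≡ false →
                   spread (square A) S ⊑ spread A U →
                   game A kg Burner U < 2 * process minOf (square A) kp S
    game-Burner< zero     kp       fuel fullS _ = <-≤-trans (process-min-pos (square A) fuel fullS) (m≤n*m _ 2)
    game-Burner< (suc kg) zero     fuel fullS _ = contradiction (process-min-pos (square A) fuel fullS) λ ()
    game-Burner< (suc kg) (suc k) {S} {U} fuel fullS reach with process-min-step (square A) fuel fullS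
    ... | x , unfolded , fuel′ rewrite unfolded with full U
    ...   | true  = s≤s z≤n
    ...   | false with full (spread A U) in fullSpread
    ...     | true  = suc-<-double-suc z≤n
    ...     | false with add-covers fullSpread x
    ...       | v , v∈ , x∈ =
      suc-<-double-suc (≤-trans (minOf-≤ (∈-map⁺ next v∈)) (game-Staller≤ kg k fuel′ follow))
      where
      next : Fin n → ℕ
      next v = game A kg Staller (add (spread A U) v)
      follow : add (spread (square A) S) x ⊑ add (spread A U) v
      follow h =
        [ add-incl {S = spread A U} ∘ reach , (λ { refl → x∈ }) ]′ (add-elim {S = spread (square A) S} h)

proposition2p1 : ∀ {n} (G : SimpleGraph n) → 1 ≤ n → Connected G →
    ((burningNumber (adj G) ≤ gameBurningNumber (adj G))
    × (gameBurningNumber (adj G)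
    ≤ coolingNumber (adj G) ⊓ (2 * burningNumber (square (adj G)) ∸ 1)))
    × ((burningNumber (adj G) ≤ gameBurningNumber′ (adj G))
    × (gameBurningNumber′ (adj G)
    ≤ coolingNumber (adj G) ⊓ (2 * burningNumber (square (adj G)))))
proposition2p1 {n@(suc _)} G _ _ =
  (process-min≤game A n Burner ∅ , ⊓-glb (game≤process-max A n Burner ∅) burnerStarts) ,
  (process-min≤game A n Staller ∅ , ⊓-glb (game≤process-max A n Staller ∅) stallerStarts)
  where
  A = adj G
  fuel : #unburned (∅ {n}) ≤ n
  fuel = ≤-reflexive #unburned-∅
  burnerStarts : gameBurningNumber A ≤ 2 * burningNumber (square A) ∸ 1
  burnerStarts =
    <⇒≤∸1 (game-Burner< A n n {∅} {∅} fuel refl (λ {v} → ⊥-elim ∘ spread-∅ (square A) {v}))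
  stallerStarts : gameBurningNumber′ A ≤ 2 * burningNumber (square A)
  stallerStarts = game-Staller≤ A n n {∅} {∅} fuel id
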